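{- There exists a subcubic outerplanar graph which is not $(1,2,2,2)$-packing colorable.
   Context: All graphs are finite and simple. A graph is subcubic if every vertex has degree at most $3$, and outerplanar if it has a planar drawing in which all vertices lie on the outer face. For a positive integer $d$, a set $A\subseteq V(G)$ is a $d$-packing if any two distinct vertices of $A$ are at distance greater than $d$ in $G$. For a nondecreasing sequence $S=(s_1,\ldots,s_m)$ of positive integers, an $S$-packing coloring of $G$ is a map $c:V(G)\to\{1,\ldots,m\}$ such that for every $i$, the set $c^{ -1}(i)$ is an $s_i$-packing; $G$ is $S$-packing colorable if such a map exists. -}

module Defs where

open import Data.Nat using (ℕ; zero; suc; _≤_; _<_)
open import Data.Bool using (Bool; true; false; if_then_else_)
open import Data.Fin using (Fin)
open import Data.List using (map; allFin)
open import Data.Nat.ListAction using (sum)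
open import Data.Vec using (Vec; lookup)
open import Data.Product using (Σ; ∃; _×_)
open import Relation.Binary.PropositionalEquality using (_≡_; _≢_)
open import Relation.Nullary using (¬_)
open import Function.Definitions using (Injective)

record Graph (n : ℕ) : Set where
  field
    adj   : Fin n → Fin n → Bool
    sym   : ∀ u v → adj u v ≡ adj v u
    irrefl : ∀ v → adj v v ≡ false
open Graph public

degree : ∀ {n} → Graph n → Fin n → ℕ
degree {n} G v = sum (map (λ w → if adj G v w then 1 else 0) (allFin n))

Subcubic : ∀ {n} → Graph n → Set
Subcubic {n} G = ∀ (v : Fin n) → degree G v ≤ 3

data Walk {n} (G : Graph n) : Fin n → Fin n → ℕ → Set where
  here : ∀ {u} → Walk G u u zero
  step : ∀ {u w v k} → adj G u w ≡ true → Walk G w v k → Walk G u v (suc k)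

DistLe : ∀ {n} → Graph n → Fin n → Fin n → ℕ → Set
DistLe G u v d = ∃ λ k → k ≤ d × Walk G u v k

IsPacking : ∀ {n} → Graph n → (Fin n → Set) → ℕ → Set
IsPacking {n} G A d =
  ∀ (u v : Fin n) → u ≢ v → A u → A v → ¬ DistLe G u v d

IsSPackingColoring : ∀ {n m} → Graph n → Vec ℕ m → (Fin n → Fin m) → Set
IsSPackingColoring {n} {m} G S c =
  ∀ (i : Fin m) → IsPacking G (λ v → c v ≡ i) (lookup S i)

SPackingColorable : ∀ {n m} → Graph n → Vec ℕ m → Set
SPackingColorable {n} {m} G S = ∃ λ (c : Fin n → Fin m) → IsSPackingColoring G S c

-- Outerplanar: the vertices can be placed in an order around a circle
-- (positions pos, injective) so that no two edges cross when drawn as chords,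
-- i.e. there are no edges ab, cd with pos a < pos c < pos b < pos d.
Outerplanar : ∀ {n} → Graph n → Set
Outerplanar {n} G =
  Σ (Fin n → ℕ) λ pos → Injective _≡_ _≡_ pos ×
    (∀ (a b c d : Fin n) → adj G a b ≡ true → adj G c d ≡ true →
       ¬ (pos a < pos c × pos c < pos b × pos b < pos d))

{-# OPTIONS --safe #-}
-- The gadget is the 7-cycle v₀ v₁ … v₆ with the chords v₀v₂ and v₃v₅, i.e. two
-- triangles v₀v₁v₂ and v₃v₄v₅ joined by the edge v₂v₃ and both attached to the
-- hub v₆. In a (1,2,2,2)-packing colouring the hub of a gadget gets colour 1.
-- Otherwise, unless v₂ gets colour 1, the vertices v₂, …, v₆ are pairwise at
-- distance at most 2 and every non-adjacent pair among them contains v₂ or v₆,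
-- so they would need five distinct colours. Hence v₂ gets colour 1, and by the
-- symmetry exchanging the two triangles so does its neighbour v₃, a contradiction.
-- So two gadgets whose hubs are joined by an edge admit no such colouring.
module Submission where

open import Defs hiding (sym)
open import Agda.Builtin.FromNat
open import Data.Bool using (Bool; true; false; _∨_)
open import Data.Bool.Properties using (∨-comm) renaming (_≟_ to _≟ᵇ_)
open import Data.Empty using (⊥-elim)
open import Data.Fin using (Fin; zero; suc; toℕ; _↑ˡ_; _↑ʳ_)
import Data.Fin.Literals as Fin
import Data.Nat.Literals as ℕ
open import Data.Fin.Properties using (_≟_; all?; toℕ-injective; ↑ˡ-injective; ↑ʳ-injective; injective⇒≤)
open import Data.List using (List; []; _∷_; map; _++_)
open import Data.Nat using (ℕ; _≤_; _<_; _≤?_; _<?_; s≤s; z≤n)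
open import Data.Nat.Properties using (≤-trans; ≤-reflexive; 1+n≰n)
import Data.Product as Product
open import Data.Product using (Σ; _×_; _,_)
open import Data.Product.Properties using (≡-dec)
open import Data.Sum using (_⊎_; inj₁; inj₂)
open import Data.Unit using (tt)
open import Data.Vec using (Vec; []; _∷_; lookup)
open import Data.Vec.Properties using (lookup-replicate)
open import Data.Vec.Relation.Unary.All using ([]; _∷_)
open import Data.Vec.Relation.Unary.AllPairs using ([]; _∷_)
open import Data.Vec.Relation.Unary.Unique.Propositional using (Unique)
open import Data.Vec.Relation.Unary.Unique.Propositional.Properties using (lookup-injective)
open import Function using (_∘_)
open import Function.Definitions using (Injective)
open import Relation.Binary.PropositionalEquality using (_≡_; _≢_; refl; sym; trans; cong)
open import Relation.Nullary using (¬_; Dec; yes; no; does; ¬?)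
open import Relation.Nullary.Decidable using (from-yes; _×-dec_; _→-dec_)

instance
  ℕ-number : Number ℕ
  ℕ-number = ℕ.number

  Fin-number : ∀ {n} → Number (Fin n)
  Fin-number {n} = Fin.number n

private
  variable
    m n : ℕ

Unique⇒length≤ : ∀ {xs : Vec (Fin n) m} → Unique xs → m ≤ n
Unique⇒length≤ xs! = injective⇒≤ (lookup-injective xs! _ _)

module _ (G : Graph n) where

  adjacent⇒distinct : ∀ {u v} → adj G u v ≡ true → u ≢ v
  adjacent⇒distinct {u} uv refl with () ← trans (sym uv) (irrefl G u)

  DistLe-mono : ∀ {u v d e} → d ≤ e → DistLe G u v d → DistLe G u v e
  DistLe-mono d≤e (k , k≤d , walk) = k , ≤-trans k≤d d≤e , walk

  adjacent⇒DistLe₁ : ∀ {u v} → adj G u v ≡ true → DistLe G u v 1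
  adjacent⇒DistLe₁ uv = 1 , s≤s z≤n , step uv here

  path⇒DistLe₂ : ∀ {u w v} → adj G u w ≡ true → adj G w v ≡ true → DistLe G u v 2
  path⇒DistLe₂ uw wv = 2 , s≤s (s≤s z≤n) , step uw (step wv here)

  packing-separates : ∀ {S : Vec ℕ m} {c : Fin n → Fin m} → IsSPackingColoring G S c →
                      ∀ {u v} → u ≢ v → DistLe G u v (lookup S (c u)) → c u ≢ c v
  packing-separates χ u≢v close cu≡cv = χ _ _ _ u≢v refl (sym cu≡cv) close

Homomorphism : Graph m → Graph n → (Fin m → Fin n) → Set
Homomorphism H G f = ∀ u v → adj H u v ≡ true → adj G (f u) (f v) ≡ true

homomorphism? : (H : Graph m) (G : Graph n) (f : Fin m → Fin n) → Dec (Homomorphism H G f)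
homomorphism? H G f =
  all? λ u → all? λ v → (adj H u v ≟ᵇ true) →-dec (adj G (f u) (f v) ≟ᵇ true)

record Monomorphism (H : Graph m) (G : Graph n) : Set where
  field
    to          : Fin m → Fin n
    injective   : Injective _≡_ _≡_ to
    homomorphic : Homomorphism H G to

open Monomorphism

_∘ᴹ_ : ∀ {k} {F : Graph k} {H : Graph m} {G : Graph n} →
       Monomorphism H G → Monomorphism F H → Monomorphism F G
κ ∘ᴹ ι = record
  { to          = to κ ∘ to ι
  ; injective   = injective ι ∘ injective κ
  ; homomorphic = λ u v → homomorphic κ _ _ ∘ homomorphic ι u v
  }

module _ {n : ℕ} where
  open import Data.List.Membership.DecPropositional {A = Fin n × Fin n} (≡-dec _≟_ _≟_) using (_∈?_)

  linked : List (Fin n × Fin n) → Fin n → Fin n → Bool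
  linked es u v = does ((u , v) ∈? es) ∨ does ((v , u) ∈? es)

  fromEdges : (es : List (Fin n × Fin n)) → (∀ v → linked es v v ≡ false) → Graph n
  fromEdges es loopless = record
    { adj    = linked es
    ; sym    = λ u v → ∨-comm (does ((u , v) ∈? es)) (does ((v , u) ∈? es))
    ; irrefl = loopless
    }

loopless? : (es : List (Fin n × Fin n)) → Dec (∀ v → linked es v v ≡ false)
loopless? es = all? λ v → linked es v v ≟ᵇ false

gadget-edges : List (Fin 7 × Fin 7)
gadget-edges =
  (0 , 1) ∷ (1 , 2) ∷ (2 , 0) ∷ (2 , 3) ∷ (3 , 4) ∷ (4 , 5) ∷ (5 , 3) ∷ (5 , 6) ∷ (6 , 0) ∷ []

Gadget : Graph 7
Gadget = fromEdges gadget-edges (from-yes (loopless? gadget-edges))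

hub : Fin 7
hub = 6

mirror : Fin 7 → Fin 7
mirror = lookup (5 ∷ 4 ∷ 3 ∷ 2 ∷ 1 ∷ 0 ∷ 6 ∷ [])

mirror-involutive : ∀ i → mirror (mirror i) ≡ i
mirror-involutive = from-yes (all? λ i → mirror (mirror i) ≟ i)

Gadget-mirror : Monomorphism Gadget Gadget
Gadget-mirror = record
  { to          = mirror
  ; injective   = λ {i} {j} eq →
      trans (sym (mirror-involutive i)) (trans (cong mirror eq) (mirror-involutive j))
  ; homomorphic = from-yes (homomorphism? Gadget Gadget mirror)
  }

S₁₂₂₂ : Vec ℕ 4
S₁₂₂₂ = 1 ∷ 2 ∷ 2 ∷ 2 ∷ []

module Colouring₁₂₂₂ {G : Graph n} {c : Fin n → Fin 4} (χ : IsSPackingColoring G S₁₂₂₂ c) where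

  private
    separates : ∀ {u v} → u ≢ v → DistLe G u v (lookup S₁₂₂₂ (c u)) → c u ≢ c v
    separates = packing-separates G {S = S₁₂₂₂} χ

    radius-nonzero : ∀ i → i ≢ zero → 2 ≤ lookup S₁₂₂₂ i
    radius-nonzero zero    i≢0 = ⊥-elim (i≢0 refl)
    radius-nonzero (suc k) _   = ≤-reflexive (sym (lookup-replicate k 2))

    radius-positive : ∀ i → 1 ≤ lookup S₁₂₂₂ i
    radius-positive zero    = s≤s z≤n
    radius-positive (suc k) = ≤-trans (s≤s z≤n) (radius-nonzero (suc k) λ ())

  adjacent⇒colours-differ : ∀ {u v} → adj G u v ≡ true → c u ≢ c v
  adjacent⇒colours-differ {u} uv = separates (adjacent⇒distinct G uv)
    (DistLe-mono G (radius-positive (c u)) (adjacent⇒DistLe₁ G uv))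

  path⇒colours-differ : ∀ {u w v} → c u ≢ zero → u ≢ v →
                        adj G u w ≡ true → adj G w v ≡ true → c u ≢ c v
  path⇒colours-differ {u} cu≢0 u≢v uw wv = separates u≢v
    (DistLe-mono G (radius-nonzero (c u) cu≢0) (path⇒DistLe₂ G uw wv))

  module _ (κ : Monomorphism Gadget G) where
    private
      differ₁ : ∀ i j → adj Gadget i j ≡ true → c (to κ i) ≢ c (to κ j)
      differ₁ i j ij = adjacent⇒colours-differ (homomorphic κ i j ij)

      differ₂ : ∀ i k j → c (to κ i) ≢ zero → i ≢ j →
                adj Gadget i k ≡ true → adj Gadget k j ≡ true → c (to κ i) ≢ c (to κ j)
      differ₂ i k j ci≢0 i≢j ik kj =
        path⇒colours-differ ci≢0 (i≢j ∘ injective κ) (homomorphic κ i k ik) (homomorphic κ k j kj)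

    hub-or-v₂-coloured-zero : c (to κ hub) ≡ zero ⊎ c (to κ 2) ≡ zero
    hub-or-v₂-coloured-zero with c (to κ hub) ≟ zero | c (to κ 2) ≟ zero
    ... | yes h≡0 | _       = inj₁ h≡0
    ... | no _    | yes l≡0 = inj₂ l≡0
    ... | no h≢0  | no l≢0  = ⊥-elim (1+n≰n (Unique⇒length≤ five-colours))
      where
        five-colours : Unique (c (to κ 6) ∷ c (to κ 2) ∷ c (to κ 3) ∷ c (to κ 4) ∷ c (to κ 5) ∷ [])
        five-colours =
          (differ₂ 6 0 2 h≢0 (λ ()) refl refl ∷ differ₂ 6 5 3 h≢0 (λ ()) refl refl ∷
           differ₂ 6 5 4 h≢0 (λ ()) refl refl ∷ differ₁ 6 5 refl ∷ []) ∷
          (differ₁ 2 3 refl ∷ differ₂ 2 3 4 l≢0 (λ ()) refl refl ∷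
           differ₂ 2 3 5 l≢0 (λ ()) refl refl ∷ []) ∷
          (differ₁ 3 4 refl ∷ differ₁ 3 5 refl ∷ []) ∷
          (differ₁ 4 5 refl ∷ []) ∷
          [] ∷ []

  hub-coloured-zero : (κ : Monomorphism Gadget G) → c (to κ hub) ≡ zero
  hub-coloured-zero κ with hub-or-v₂-coloured-zero κ | hub-or-v₂-coloured-zero (κ ∘ᴹ Gadget-mirror)
  ... | inj₁ h≡0 | _        = h≡0
  ... | inj₂ _   | inj₁ h≡0 = h≡0
  ... | inj₂ l≡0 | inj₂ r≡0 = ⊥-elim (adjacent⇒colours-differ (homomorphic κ 2 3 refl) (trans l≡0 (sym r≡0)))

twoGadgets-edges : List (Fin 14 × Fin 14)
twoGadgets-edges =
  map (Product.map (_↑ˡ 7) (_↑ˡ 7)) gadget-edges ++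
  map (Product.map (7 ↑ʳ_) (7 ↑ʳ_)) gadget-edges ++
  (hub ↑ˡ 7 , 7 ↑ʳ hub) ∷ []

TwoGadgets : Graph 14
TwoGadgets = fromEdges twoGadgets-edges (from-yes (loopless? twoGadgets-edges))

left-copy right-copy : Monomorphism Gadget TwoGadgets
left-copy = record
  { to          = _↑ˡ 7
  ; injective   = ↑ˡ-injective 7 _ _
  ; homomorphic = from-yes (homomorphism? Gadget TwoGadgets (_↑ˡ 7))
  }
right-copy = record
  { to          = 7 ↑ʳ_
  ; injective   = ↑ʳ-injective 7 _ _
  ; homomorphic = from-yes (homomorphism? Gadget TwoGadgets (7 ↑ʳ_))
  }

TwoGadgets-subcubic : Subcubic TwoGadgets
TwoGadgets-subcubic = from-yes (all? λ v → degree TwoGadgets v ≤? 3)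

TwoGadgets-outerplanar : Outerplanar TwoGadgets
TwoGadgets-outerplanar = toℕ , toℕ-injective , λ a b c d ab cd → chords-do-not-cross a b ab c d cd
  where
    -- Deciding whether ab is an edge before quantifying over c and d prunes the search.
    chords-do-not-cross : ∀ a b → adj TwoGadgets a b ≡ true → ∀ c d → adj TwoGadgets c d ≡ true →
                          ¬ (toℕ a < toℕ c × toℕ c < toℕ b × toℕ b < toℕ d)
    chords-do-not-cross = from-yes
      (all? λ a → all? λ b → (adj TwoGadgets a b ≟ᵇ true) →-dec
        (all? λ c → all? λ d → (adj TwoGadgets c d ≟ᵇ true) →-dec
          ¬? ((toℕ a <? toℕ c) ×-dec ((toℕ c <? toℕ b) ×-dec (toℕ b <? toℕ d)))))

TwoGadgets-not-colourable : ¬ SPackingColorable TwoGadgets (1 ∷ 2 ∷ 2 ∷ 2 ∷ [])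
TwoGadgets-not-colourable (c , χ) =
  adjacent⇒colours-differ hubs-adjacent
    (trans (hub-coloured-zero left-copy) (sym (hub-coloured-zero right-copy)))
  where
    open Colouring₁₂₂₂ χ

    hubs-adjacent : adj TwoGadgets (to left-copy hub) (to right-copy hub) ≡ true
    hubs-adjacent = refl

proposition7 : Σ ℕ λ n → Σ (Graph n) λ G →
    Subcubic G × Outerplanar G × ¬ SPackingColorable G (1 ∷ 2 ∷ 2 ∷ 2 ∷ [])
proposition7 = 14 , TwoGadgets , TwoGadgets-subcubic , TwoGadgets-outerplanar , TwoGadgets-not-colourable
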